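{- Let $p \ge 2$ and $m$ be integers with $0 \le m \le \beta(K_p)=\frac12(p-1)(p-2)$, and let $K_p - me$ be any graph obtained from the complete graph $K_p$ by deleting $m$ edges. If $K_p - me$ is connected, then there exists a quadrangulation $(K_p - me)[:] \hookrightarrow \Sigma_g$ with $g = \beta(K_p) - m$. Moreover, whenever $g \ge 1$ and $p \ge 4(m+1)$, every such quadrangulation is minimal in $\Sigma_g$.
   Context: All graphs are finite, undirected and simple. $\Sigma_g$ denotes the closed orientable surface of genus $g$. If a graph $G$ is 2-cell embedded in $\Sigma_g$, the components of $\Sigma_g - G$ are called regions. A quadrangulation of $\Sigma_g$ with graph $G$ is a 2-cell embedding $G \hookrightarrow \Sigma_g$ in which each region is bounded by a simple circuit of length 4 in $G$. A quadrangulation of $\Sigma_g$ is minimal in $\Sigma_g$ if its number of vertices is minimal among all quadrangulations of $\Sigma_g$ (with any graph). For a connected graph $G$, $\beta(G)=|E(G)|-|V(G)|+1$. The 2-fold interlacement $G[:]$ of $G$ is the graph whose vertex set is the disjoint union $V(G')\sqcup V(G'')$ of two disjoint copies $G', G''$ of $G$, and whose edge set consists of $E(G')\sqcup E(G'')$ together with, for each vertex $v'\in V(G')$ (copy of $v \in V(G)$), the edges joining $v'$ to each vertex $u''\in V(G'')$ such that $u$ is adjacent to $v$ in $G$. -}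

module Defs where

open import Data.Nat using (ℕ; zero; suc; _+_; _*_; _∸_; _<ᵇ_; _≤_)
open import Data.Bool using (Bool; true; false; not; _∧_; if_then_else_; T)
open import Data.Fin using (Fin; toℕ; splitAt)
import Data.Fin as F
open import Data.Fin.Properties using (_≟_)
open import Data.Sum using (_⊎_; inj₁; inj₂; [_,_])
open import Data.Product using (Σ; ∃; _×_; _,_; proj₁; proj₂)
open import Function using (id; _∘_)
open import Relation.Nullary using (¬_; yes; no)
open import Relation.Nullary.Decidable using (⌊_⌋)
open import Relation.Binary.PropositionalEquality using (_≡_; refl; sym; _≢_; subst)
open import Data.Empty using (⊥-elim)

record Graph (n : ℕ) : Set where
  field
    adj    : Fin n → Fin n → Bool
    adj-sym    : ∀ u v → adj u v ≡ adj v u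
    adj-irrefl : ∀ v → adj v v ≡ false
open Graph public

sumFin : ∀ {n} → (Fin n → ℕ) → ℕ
sumFin {zero}  f = 0
sumFin {suc n} f = f F.zero + sumFin (f ∘ F.suc)

numEdges : ∀ {n} → Graph n → ℕ
numEdges {n} G =
  sumFin λ u → sumFin λ v →
    if (toℕ u <ᵇ toℕ v) ∧ adj G u v then 1 else 0

data Walk {n} (G : Graph n) : Fin n → Fin n → Set where
  here : ∀ {v} → Walk G v v
  step : ∀ {u w v} → T (adj G u w) → Walk G w v → Walk G u v

Connected : ∀ {n} → Graph n → Set
Connected G = ∀ u v → Walk G u v

-- cycle rank β(G) = |E| - |V| + 1  (used only for connected graphs)
β : ∀ {n} → Graph n → ℕ
β {n} G = numEdges G + 1 ∸ n

ne-sym : ∀ {n} (u v : Fin n) → not ⌊ u ≟ v ⌋ ≡ not ⌊ v ≟ u ⌋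
ne-sym u v with u ≟ v | v ≟ u
... | yes _ | yes _ = refl
... | no _  | no _  = refl
... | yes p | no q  = ⊥-elim (q (sym p))
... | no q  | yes p = ⊥-elim (q (sym p))

ne-irrefl : ∀ {n} (v : Fin n) → not ⌊ v ≟ v ⌋ ≡ false
ne-irrefl v with v ≟ v
... | yes _ = refl
... | no q  = ⊥-elim (q refl)

complete : (p : ℕ) → Graph p
complete p = record
  { adj = λ u v → not ⌊ u ≟ v ⌋
  ; adj-sym = ne-sym
  ; adj-irrefl = ne-irrefl }

-- 2-fold interlacement G[:] on Fin (n + n):
-- vertices of Fin n ⊎ Fin n via splitAt (left = copy G', right = copy G'').
-- Edges: u'v' and u''v'' for uv ∈ E(G) (the two copies), and v'u'' for
-- uv ∈ E(G).  In all four cases x ~ y iff (base x) ~ (base y) in G.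

base : ∀ {n} → Fin (n + n) → Fin n
base {n} x = [ id , id ] (splitAt n x)

interlace : ∀ {n} → Graph n → Graph (n + n)
interlace {n} G = record
  { adj = λ x y → adj G (base x) (base y)
  ; adj-sym = λ x y → adj-sym G (base x) (base y)
  ; adj-irrefl = λ x → adj-irrefl G (base x) }

-- Combinatorial 2-cell embeddings in orientable surfaces (rotation systems,
-- Heffter–Edmonds–Ringel).

record Dart {n} (G : Graph n) : Set where
  constructor dart
  field
    tail : Fin n
    head : Fin n
    isEdge : T (adj G tail head)
open Dart public

rev : ∀ {n} {G : Graph n} → Dart G → Dart G
rev {G = G} (dart u v e) = dart v u (subst T (adj-sym G u v) e)

iter : ∀ {A : Set} → (A → A) → ℕ → A → A
iter f zero    a = a
iter f (suc k) a = f (iter f k a)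

record RotationSystem {n} (G : Graph n) : Set where
  field
    ρ        : Dart G → Dart G
    ρ-tail   : ∀ d → tail (ρ d) ≡ tail d
    ρ-inj    : ∀ d d' → ρ d ≡ ρ d' → d ≡ d'
    ρ-cyclic : ∀ d d' → tail d ≡ tail d' → ∃ λ k → iter ρ k d ≡ d'
open RotationSystem public

φ : ∀ {n} {G : Graph n} → RotationSystem G → Dart G → Dart G
φ R d = ρ R (rev d)

SameFace : ∀ {n} {G : Graph n} → RotationSystem G → Dart G → Dart G → Set
SameFace R d d' = ∃ λ k → iter (φ R) k d ≡ d'

HasFaces : ∀ {n} {G : Graph n} → RotationSystem G → ℕ → Set
HasFaces {G = G} R F =
  Σ (Fin F → Dart G) λ rep →
    (∀ i j → SameFace R (rep i) (rep j) → i ≡ j) ×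
    (∀ d → ∃ λ i → SameFace R (rep i) d)

record Embedding {n} (G : Graph n) (g : ℕ) : Set where
  field
    connected : Connected G
    rot       : RotationSystem G
    nFaces    : ℕ
    faces     : HasFaces rot nFaces
    euler     : n + nFaces + 2 * g ≡ numEdges G + 2
open Embedding public

IsQuadrangulation : ∀ {n} {G : Graph n} {g} → Embedding G g → Set
IsQuadrangulation E = ∀ d →
  let f = φ (rot E)
      v₀ = tail d
      v₁ = tail (f d)
      v₂ = tail (f (f d))
      v₃ = tail (f (f (f d)))
  in iter f 4 d ≡ d
     × v₀ ≢ v₁ × v₀ ≢ v₂ × v₀ ≢ v₃ × v₁ ≢ v₂ × v₁ ≢ v₃ × v₂ ≢ v₃

Quadrangulation : ∀ {n} → Graph n → ℕ → Set
Quadrangulation G g = Σ (Embedding G g) IsQuadrangulation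

IsMinimal : ∀ {n} {G : Graph n} {g} → Quadrangulation G g → Set
IsMinimal {n} {g = g} _ = ∀ (n' : ℕ) (H : Graph n') → Quadrangulation H g → n ≤ n'

{-# OPTIONS --safe #-}
-- Label a dart of G[:] by the copies (G′ or G″) containing its ends and its underlying dart of G.
-- Fix a cyclic order of the neighbours of every vertex of G.  At v′ let the rotation alternate
-- between darts into G′ and into G″ while running backwards through the neighbours of v, and at
-- v″ forwards.  Then every face is a quadrangle v′ w′ v″ u″ and contains exactly one dart inside
-- G′, so G[:] has 2p vertices, 4|E(G)| edges and 2|E(G)| faces, and Euler's formula gives the
-- genus |E(G)| − p + 1 = β(K_p) − m.
-- Minimality: a quadrangulation of Σ_g with n vertices has 2n + 4g − 4 ≤ n(n − 1)/2 edges, i.e.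
-- 4n + 8g ≤ n(n − 1) + 8.  This bound is monotone in n ≥ 5, and for g = β(K_p) − m it already
-- fails at n = 2p − 1 once p ≥ 4(m + 1).
module Submission where

open import Defs
open import Data.Nat using (ℕ; zero; suc; _+_; _*_; _∸_; _≤_; _<_; z≤n; s≤s; s≤s⁻¹; _<ᵇ_; NonZero; _≤?_)
open import Data.Nat.DivMod using (_%_; _/_; m%n<n; m≡m%n+[m/n]*n; [m+kn]%n≡m%n; [m+n]%n≡m%n; m<n⇒m%n≡m)
open import Data.Nat.Properties hiding (_≟_)
open import Data.Nat.Tactic.RingSolver using (solve-∀; solve)
open import Data.List using (_∷_; [])
open import Algebra.Properties.CommutativeSemigroup +-commutativeSemigroup
  using () renaming (interchange to +-interchange)
open import Data.Bool using (Bool; true; false; not; _∧_; if_then_else_; T)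
open import Data.Bool.Properties using (T-irrelevant)
open import Data.Unit using (tt)
open import Data.Empty using (⊥; ⊥-elim)
open import Data.Fin.Patterns using (0F; 1F; 2F; 3F)
open import Data.Fin as F using (Fin; toℕ; fromℕ<; _↑ˡ_; _↑ʳ_; splitAt; join)
open import Data.Fin.Properties
  using (toℕ-injective; toℕ-fromℕ<; toℕ<n; _≟_; +↔⊎; *↔×; injective⇒≤; splitAt-↑ˡ; splitAt-↑ʳ; join-splitAt)
open import Data.Sum using (_⊎_; inj₁; inj₂; [_,_])
open import Data.Sum.Function.Propositional using (_⊎-cong_)
open import Data.Product using (Σ; ∃; _×_; _,_; proj₁; proj₂)
import Data.Product.Function.Dependent.Propositional as Σ
open import Function using (_∘_; id; const; _↔_; mk↔ₛ′; Inverse)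
open import Function.Properties.Inverse using (↔-refl; ↔-sym; ↔-trans; ↔⇒↣)
open import Function.Bundles using (Injection)
open import Relation.Binary.PropositionalEquality hiding ([_])
open import Relation.Nullary using (yes; no)
open import Relation.Nullary.Decidable using (⌊_⌋)

open Inverse using (to; from; strictlyInverseˡ; strictlyInverseʳ)

sumFin-cong : ∀ {n} {f g : Fin n → ℕ} → (∀ i → f i ≡ g i) → sumFin f ≡ sumFin g
sumFin-cong {zero}  eq = refl
sumFin-cong {suc n} eq = cong₂ _+_ (eq F.zero) (sumFin-cong (eq ∘ F.suc))

sumFin-mono : ∀ {n} {f g : Fin n → ℕ} → (∀ i → f i ≤ g i) → sumFin f ≤ sumFin g
sumFin-mono {zero}  le = z≤n
sumFin-mono {suc n} le = +-mono-≤ (le F.zero) (sumFin-mono (le ∘ F.suc))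

sumFin-const : ∀ n c → sumFin {n} (λ _ → c) ≡ n * c
sumFin-const zero    c = refl
sumFin-const (suc n) c = cong (c +_) (sumFin-const n c)

sumFin-+ : ∀ {n} (f g : Fin n → ℕ) → sumFin (λ i → f i + g i) ≡ sumFin f + sumFin g
sumFin-+ {zero}  f g = refl
sumFin-+ {suc n} f g = begin
  (f F.zero + g F.zero) + sumFin (λ i → f (F.suc i) + g (F.suc i))
    ≡⟨ cong ((f F.zero + g F.zero) +_) (sumFin-+ (f ∘ F.suc) (g ∘ F.suc)) ⟩
  (f F.zero + g F.zero) + (sumFin (f ∘ F.suc) + sumFin (g ∘ F.suc))
    ≡⟨ +-interchange (f F.zero) (g F.zero) (sumFin (f ∘ F.suc)) (sumFin (g ∘ F.suc)) ⟩
  (f F.zero + sumFin (f ∘ F.suc)) + (g F.zero + sumFin (g ∘ F.suc)) ∎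
  where open ≡-Reasoning

sumFin-swap : ∀ {m n} (f : Fin m → Fin n → ℕ) →
  sumFin (λ u → sumFin (f u)) ≡ sumFin (λ v → sumFin (λ u → f u v))
sumFin-swap {zero}  {n} f = sym (trans (sumFin-const n 0) (*-zeroʳ n))
sumFin-swap {suc m} f = trans (cong (sumFin (f F.zero) +_) (sumFin-swap (f ∘ F.suc)))
  (sym (sumFin-+ (f F.zero) (λ v → sumFin (λ u → f (F.suc u) v))))

sumFin-↑ : ∀ {m n} (f : Fin (m + n) → ℕ) →
  sumFin f ≡ sumFin (λ i → f (i ↑ˡ n)) + sumFin (λ i → f (m ↑ʳ i))
sumFin-↑ {zero}      f = refl
sumFin-↑ {suc m} {n} f = trans (cong (f F.zero +_) (sumFin-↑ {m} {n} (f ∘ F.suc)))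
  (sym (+-assoc (f F.zero) _ _))

Σ-Fin-suc↔ : ∀ {n} {P : Fin (suc n) → Set} → Σ (Fin (suc n)) P ↔ (P F.zero ⊎ Σ (Fin n) (P ∘ F.suc))
Σ-Fin-suc↔ = mk↔ₛ′
  (λ { (F.zero , x) → inj₁ x ; (F.suc i , x) → inj₂ (i , x) })
  (λ { (inj₁ x) → F.zero , x ; (inj₂ (i , x)) → F.suc i , x })
  (λ { (inj₁ x) → refl ; (inj₂ (i , x)) → refl })
  (λ { (F.zero , x) → refl ; (F.suc i , x) → refl })

sumFin↔Σ : ∀ {n} (f : Fin n → ℕ) → Fin (sumFin f) ↔ Σ (Fin n) (Fin ∘ f)
sumFin↔Σ {zero}  f = mk↔ₛ′ (λ ()) (λ ()) (λ ()) (λ ())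
sumFin↔Σ {suc n} f =
  ↔-trans +↔⊎ (↔-trans (↔-refl ⊎-cong sumFin↔Σ (f ∘ F.suc)) (↔-sym Σ-Fin-suc↔))

Fin-↔⇒≡ : ∀ {m n} → Fin m ↔ Fin n → m ≡ n
Fin-↔⇒≡ B = ≤-antisym (injective⇒≤ (Injection.injective (↔⇒↣ B)))
                      (injective⇒≤ (Injection.injective (↔⇒↣ (↔-sym B))))

Dart-≡ : ∀ {n} {G : Graph n} {d d' : Dart G} → tail d ≡ tail d' → head d ≡ head d' → d ≡ d'
Dart-≡ {d = dart u v e} {dart .u .v e'} refl refl = cong (dart u v) (T-irrelevant e e')

rev-involutive : ∀ {n} {G : Graph n} (d : Dart G) → rev (rev d) ≡ d
rev-involutive d = Dart-≡ refl refl

adj⇒≢ : ∀ {n} (G : Graph n) {u v} → T (adj G u v) → u ≢ v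
adj⇒≢ G {u} e refl = subst T (adj-irrefl G u) e

indicator : Bool → ℕ
indicator b = if b then 1 else 0

indicator↔T : ∀ b → Fin (indicator b) ↔ T b
indicator↔T true  = mk↔ₛ′ _ (λ _ → F.zero) (λ _ → refl) (λ { F.zero → refl ; (F.suc ()) })
indicator↔T false = mk↔ₛ′ (λ ()) (λ ()) (λ ()) (λ ())

deg : ∀ {n} → Graph n → Fin n → ℕ
deg G u = sumFin (indicator ∘ adj G u)

degSum : ∀ {n} → Graph n → ℕ
degSum G = sumFin (deg G)

neighbours↔ : ∀ {n} (G : Graph n) u → Fin (deg G u) ↔ Σ (Fin n) (T ∘ adj G u)
neighbours↔ G u = ↔-trans (sumFin↔Σ _) (Σ.congˡ (indicator↔T _))

darts↔ : ∀ {n} (G : Graph n) → Fin (degSum G) ↔ Dart G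
darts↔ G = ↔-trans (sumFin↔Σ (deg G)) (↔-trans (Σ.congˡ (neighbours↔ G _)) Σ↔Dart)
  where
  Σ↔Dart : Σ _ (λ u → Σ _ (T ∘ adj G u)) ↔ Dart G
  Σ↔Dart = mk↔ₛ′ (λ (u , v , e) → dart u v e) (λ d → tail d , head d , isEdge d)
    (λ _ → refl) (λ _ → refl)

indicator-split : ∀ {n} (G : Graph n) u v → indicator (adj G u v) ≡
  indicator ((toℕ u <ᵇ toℕ v) ∧ adj G u v) + indicator ((toℕ v <ᵇ toℕ u) ∧ adj G v u)
indicator-split G u v with toℕ u <ᵇ toℕ v in u<v | toℕ v <ᵇ toℕ u in v<u
... | true  | true  = ⊥-elim (<-asym (<ᵇ⇒< (toℕ u) (toℕ v) (subst T (sym u<v) tt))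
                                   (<ᵇ⇒< (toℕ v) (toℕ u) (subst T (sym v<u) tt)))
... | true  | false = sym (+-identityʳ _)
... | false | true  = cong indicator (adj-sym G u v)
... | false | false = cong indicator (trans (cong (adj G u) (sym u≡v)) (adj-irrefl G u))
  where
  u≡v : u ≡ v
  u≡v = toℕ-injective (≤-antisym (≮⇒≥ (λ lt → subst T v<u (<⇒<ᵇ lt)))
                                 (≮⇒≥ (λ lt → subst T u<v (<⇒<ᵇ lt))))

handshake : ∀ {n} (G : Graph n) → degSum G ≡ 2 * numEdges G
handshake {n} G = begin
  sumFin (λ u → sumFin (λ v → indicator (adj G u v)))
    ≡⟨ sumFin-cong (λ u → trans (sumFin-cong (indicator-split G u)) (sumFin-+ (below u) (λ v → below v u))) ⟩
  sumFin (λ u → sumFin (below u) + sumFin (λ v → below v u))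
    ≡⟨ sumFin-+ (λ u → sumFin (below u)) (λ u → sumFin (λ v → below v u)) ⟩
  numEdges G + sumFin (λ u → sumFin (λ v → below v u))
    ≡⟨ cong (numEdges G +_) (trans (sym (sumFin-swap below)) (sym (+-identityʳ _))) ⟩
  2 * numEdges G ∎
  where
  open ≡-Reasoning
  below : Fin n → Fin n → ℕ
  below u v = indicator ((toℕ u <ᵇ toℕ v) ∧ adj G u v)

deg-complete : ∀ {n} (u : Fin n) → deg (complete n) u ≡ n ∸ 1
deg-complete {suc n}       F.zero    = trans (sumFin-const n 1) (*-identityʳ n)
deg-complete {suc (suc n)} (F.suc u) = cong suc (trans (sumFin-cong (cong (indicator ∘ not) ∘ ≟-suc)) (deg-complete u))
  where
  ≟-suc : ∀ v → ⌊ F.suc u ≟ F.suc v ⌋ ≡ ⌊ u ≟ v ⌋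
  ≟-suc v with u ≟ v
  ... | yes _ = refl
  ... | no  _ = refl

degSum-complete : ∀ n → degSum (complete n) ≡ n * (n ∸ 1)
degSum-complete n = trans (sumFin-cong (deg-complete {n})) (sumFin-const n (n ∸ 1))

degSum-≤ : ∀ {n} (G : Graph n) → degSum G ≤ n * (n ∸ 1)
degSum-≤ {n} G = ≤-trans (sumFin-mono (λ u → sumFin-mono (adj≤complete u)))
                         (≤-reflexive (degSum-complete n))
  where
  adj≤complete : ∀ u v → indicator (adj G u v) ≤ indicator (adj (complete n) u v)
  adj≤complete u v with u ≟ v
  ... | yes refl = ≤-reflexive (cong indicator (adj-irrefl G u))
  ... | no  _    with adj G u v
  ...   | true  = ≤-refl
  ...   | false = z≤n

iter-+ : ∀ {A : Set} (f : A → A) m n x → iter f (m + n) x ≡ iter f m (iter f n x)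
iter-+ f zero    n x = refl
iter-+ f (suc m) n x = cong f (iter-+ f m n x)

iter-suc : ∀ {A : Set} (f : A → A) n x → iter f n (f x) ≡ iter f (suc n) x
iter-suc f zero    x = refl
iter-suc f (suc n) x = cong f (iter-suc f n x)

iter-commute : ∀ {A B : Set} {f : A → A} {g : B → B} (h : A → B) →
  (∀ x → h (f x) ≡ g (h x)) → ∀ n x → h (iter f n x) ≡ iter g n (h x)
iter-commute h comm zero    x = refl
iter-commute {g = g} h comm (suc n) x = trans (comm _) (cong g (iter-commute h comm n x))

iter-%-period : ∀ {A : Set} (f : A → A) k .{{_ : NonZero k}} → (∀ x → iter f k x ≡ x) →
  ∀ n x → iter f (n % k) x ≡ iter f n x
iter-%-period f k period n x = begin
  iter f (n % k) x                      ≡⟨ cong (iter f (n % k)) (sym (periods (n / k))) ⟩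
  iter f (n % k) (iter f (n / k * k) x) ≡⟨ sym (iter-+ f (n % k) (n / k * k) x) ⟩
  iter f (n % k + n / k * k) x          ≡⟨ cong (λ m → iter f m x) (sym (m≡m%n+[m/n]*n n k)) ⟩
  iter f n x                            ∎
  where
  open ≡-Reasoning
  periods : ∀ q → iter f (q * k) x ≡ x
  periods zero    = refl
  periods (suc q) = trans (iter-+ f k (q * k) x) (trans (cong (iter f k) (periods q)) (period x))

Reaches : ∀ {A : Set} → (A → A) → A → A → Set
Reaches f x y = ∃ λ n → iter f n x ≡ y

Reaches-trans : ∀ {A : Set} {f : A → A} {x y z} → Reaches f x y → Reaches f y z → Reaches f x z
Reaches-trans {f = f} (m , refl) (n , refl) = n + m , iter-+ f n m _

Reaches-map : ∀ {A B : Set} {f : A → A} {g : B → B} (h : A → B) →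
  (∀ x → Reaches g (h x) (h (f x))) → ∀ {x y} → Reaches f x y → Reaches g (h x) (h y)
Reaches-map h reach (zero  , refl) = 0 , refl
Reaches-map h reach (suc n , refl) = Reaches-trans (Reaches-map h reach (n , refl)) (reach _)

Reaches-invariant : ∀ {A B : Set} {f : A → A} (c : A → B) →
  (∀ x → c (f x) ≡ c x) → ∀ {x y} → Reaches f x y → c x ≡ c y
Reaches-invariant {f = f} c inv (n , refl) = sym (go n)
  where
  go : ∀ n → c (iter f n _) ≡ c _
  go zero    = refl
  go (suc n) = trans (inv _) (go n)

Reaches-reverse : ∀ {A : Set} {f g : A → A} → (∀ x → g (f x) ≡ x) →
  ∀ {x y} → Reaches f x y → Reaches g y x
Reaches-reverse {f = f} {g} g∘f (n , refl) = n , go n _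
  where
  go : ∀ n x → iter g n (iter f n x) ≡ x
  go zero    x = refl
  go (suc n) x = trans (sym (iter-suc g n _)) (trans (cong (iter g n) (g∘f _)) (go n x))

Reaches-return : ∀ {A : Set} (f : A → A) {k j x} → iter f k x ≡ x → j ≤ k → Reaches f (iter f j x) x
Reaches-return f {k} {j} {x} period j≤k = k ∸ j , (begin
  iter f (k ∸ j) (iter f j x) ≡⟨ sym (iter-+ f (k ∸ j) j x) ⟩
  iter f (k ∸ j + j) x        ≡⟨ cong (λ m → iter f m x) (m∸n+n≡m j≤k) ⟩
  iter f k x                  ≡⟨ period ⟩
  x                           ∎)
  where open ≡-Reasoning

csuc : ∀ {n} → Fin n → Fin n
csuc {suc n} i = fromℕ< (m%n<n (suc (toℕ i)) (suc n))

cpred : ∀ {n} → Fin n → Fin n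
cpred {suc n} = iter csuc n

toℕ-iter-csuc : ∀ {n} (i : Fin (suc n)) k → toℕ (iter csuc k i) ≡ (toℕ i + k) % suc n
toℕ-iter-csuc {n} i zero    = sym (trans (cong (_% suc n) (+-identityʳ (toℕ i))) (m<n⇒m%n≡m (toℕ<n i)))
toℕ-iter-csuc {n} i (suc k) = begin
  toℕ (csuc (iter csuc k i))   ≡⟨ toℕ-fromℕ< _ ⟩
  suc (toℕ (iter csuc k i)) % N ≡⟨ cong (λ m → suc m % N) (toℕ-iter-csuc i k) ⟩
  suc ((toℕ i + k) % N) % N     ≡⟨ suc-% (toℕ i + k) ⟩
  suc (toℕ i + k) % N           ≡⟨ cong (_% N) (sym (+-suc (toℕ i) k)) ⟩
  (toℕ i + suc k) % N           ∎
  where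
  open ≡-Reasoning
  N = suc n
  suc-% : ∀ m → suc (m % N) % N ≡ suc m % N
  suc-% m = sym (trans (cong (λ z → suc z % N) (m≡m%n+[m/n]*n m N)) ([m+kn]%n≡m%n (suc (m % N)) (m / N) N))

iter-csuc-period : ∀ {n} (i : Fin n) → iter csuc n i ≡ i
iter-csuc-period {suc n} i = toℕ-injective (begin
  toℕ (iter csuc (suc n) i) ≡⟨ toℕ-iter-csuc i (suc n) ⟩
  (toℕ i + suc n) % suc n   ≡⟨ [m+n]%n≡m%n (toℕ i) (suc n) ⟩
  toℕ i % suc n             ≡⟨ m<n⇒m%n≡m (toℕ<n i) ⟩
  toℕ i                     ∎)
  where open ≡-Reasoning

cpred-csuc : ∀ {n} (i : Fin n) → cpred (csuc i) ≡ i
cpred-csuc {suc n} i = trans (iter-suc csuc n i) (iter-csuc-period i)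

csuc-cpred : ∀ {n} (i : Fin n) → csuc (cpred i) ≡ i
csuc-cpred {suc n} = iter-csuc-period

csuc-reaches : ∀ {n} (i j : Fin n) → Reaches csuc i j
csuc-reaches {suc n} i j = (suc n ∸ toℕ i) + toℕ j , toℕ-injective (begin
  toℕ (iter csuc ((N ∸ toℕ i) + toℕ j) i) ≡⟨ toℕ-iter-csuc i _ ⟩
  (toℕ i + ((N ∸ toℕ i) + toℕ j)) % N     ≡⟨ cong (_% N) (sym (+-assoc (toℕ i) _ (toℕ j))) ⟩
  (toℕ i + (N ∸ toℕ i) + toℕ j) % N       ≡⟨ cong (λ m → (m + toℕ j) % N) (m+[n∸m]≡n (<⇒≤ (toℕ<n i))) ⟩
  (N + toℕ j) % N                         ≡⟨ cong (_% N) (+-comm N (toℕ j)) ⟩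
  (toℕ j + N) % N                         ≡⟨ [m+n]%n≡m%n (toℕ j) N ⟩
  toℕ j % N                               ≡⟨ m<n⇒m%n≡m (toℕ<n j) ⟩
  toℕ j                                   ∎)
  where
  open ≡-Reasoning
  N = suc n

module Rotation {n} (G : Graph n) where

  index : (d : Dart G) → Fin (deg G (tail d))
  index d = from (neighbours↔ G (tail d)) (head d , isEdge d)

  dartAt : ∀ v → Fin (deg G v) → Dart G
  dartAt v i = dart v (proj₁ (to (neighbours↔ G v) i)) (proj₂ (to (neighbours↔ G v) i))

  index-dartAt : ∀ v i → index (dartAt v i) ≡ i
  index-dartAt v = strictlyInverseʳ (neighbours↔ G v)

  dartAt-index : ∀ d → dartAt (tail d) (index d) ≡ d
  dartAt-index d = cong (λ (u , e) → dart (tail d) u e) (strictlyInverseˡ (neighbours↔ G (tail d)) _)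

  next : Dart G → Dart G
  next d = dartAt (tail d) (csuc (index d))

  prev : Dart G → Dart G
  prev d = dartAt (tail d) (cpred (index d))

  prev-next : ∀ d → prev (next d) ≡ d
  prev-next d = trans (cong (dartAt (tail d) ∘ cpred) (index-dartAt (tail d) _))
                      (trans (cong (dartAt (tail d)) (cpred-csuc (index d))) (dartAt-index d))

  next-prev : ∀ d → next (prev d) ≡ d
  next-prev d = trans (cong (dartAt (tail d) ∘ csuc) (index-dartAt (tail d) _))
                      (trans (cong (dartAt (tail d)) (csuc-cpred (index d))) (dartAt-index d))

  next-reaches : ∀ d d' → tail d ≡ tail d' → Reaches next d d'
  next-reaches d d' refl = subst₂ (Reaches next) (dartAt-index d) (dartAt-index d')
    (Reaches-map (dartAt (tail d)) (λ i → 1 , cong (dartAt (tail d) ∘ csuc) (index-dartAt (tail d) i))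
                 (csuc-reaches (index d) (index d')))

  prev-reaches : ∀ d d' → tail d ≡ tail d' → Reaches prev d d'
  prev-reaches d d' eq = Reaches-reverse prev-next (next-reaches d' d (sym eq))

QuadrangularAt : ∀ {A B : Set} → (A → A) → (A → B) → A → Set
QuadrangularAt f t d =
  iter f 4 d ≡ d
  × t d ≢ t (f d) × t d ≢ t (f (f d)) × t d ≢ t (f (f (f d)))
  × t (f d) ≢ t (f (f d)) × t (f d) ≢ t (f (f (f d))) × t (f (f d)) ≢ t (f (f (f d)))

QuadrangularAt-next : ∀ {A B : Set} {f : A → A} {t : A → B} {d} →
  QuadrangularAt f t d → QuadrangularAt f t (f d)
QuadrangularAt-next {f = f} {t} (period , n01 , n02 , n03 , n12 , n13 , n23) =
  cong f period , n12 , n13 , (λ e → n01 (sym (trans e (cong t period))))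
  , n23 , (λ e → n02 (sym (trans e (cong t period)))) , (λ e → n03 (sym (trans e (cong t period))))

QuadrangularAt-reaches : ∀ {A B : Set} {f : A → A} {t : A → B} {d d'} →
  QuadrangularAt f t d → Reaches f d d' → QuadrangularAt f t d'
QuadrangularAt-reaches             q (zero  , refl) = q
QuadrangularAt-reaches {f = f} {t} q (suc n , refl) =
  QuadrangularAt-next {f = f} {t} (QuadrangularAt-reaches {f = f} {t} q (n , refl))

QuadrangularAt-map : ∀ {A A' B : Set} {f : A → A} {g : A' → A'} {t : A' → B} (h : A → A') →
  (∀ x → h (f x) ≡ g (h x)) → ∀ {x} → QuadrangularAt f (t ∘ h) x → QuadrangularAt g t (h x)
QuadrangularAt-map {f = f} {g} {t} h comm {x} (period , n01 , n02 , n03 , n12 , n13 , n23) =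
  trans (sym (moved 4)) (cong h period)
  , pull 0 1 n01 , pull 0 2 n02 , pull 0 3 n03 , pull 1 2 n12 , pull 1 3 n13 , pull 2 3 n23
  where
  moved : ∀ k → h (iter f k x) ≡ iter g k (h x)
  moved k = iter-commute h comm k x
  pull : ∀ i j → t (h (iter f i x)) ≢ t (h (iter f j x)) → t (iter g i (h x)) ≢ t (iter g j (h x))
  pull i j ne e = ne (trans (cong t (moved i)) (trans e (sym (cong t (moved j)))))

QuadrangularAt-tails-injective : ∀ {A B : Set} {f : A → A} {t : A → B} {d} → QuadrangularAt f t d →
  ∀ (r r' : Fin 4) → t (iter f (toℕ r) d) ≡ t (iter f (toℕ r') d) → r ≡ r'
QuadrangularAt-tails-injective (_ , n01 , n02 , n03 , n12 , n13 , n23) = go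
  where
  go : ∀ r r' → _ → r ≡ r'
  go 0F 0F _ = refl
  go 0F 1F e = ⊥-elim (n01 e)
  go 0F 2F e = ⊥-elim (n02 e)
  go 0F 3F e = ⊥-elim (n03 e)
  go 1F 0F e = ⊥-elim (n01 (sym e))
  go 1F 1F _ = refl
  go 1F 2F e = ⊥-elim (n12 e)
  go 1F 3F e = ⊥-elim (n13 e)
  go 2F 0F e = ⊥-elim (n02 (sym e))
  go 2F 1F e = ⊥-elim (n12 (sym e))
  go 2F 2F _ = refl
  go 2F 3F e = ⊥-elim (n23 e)
  go 3F 0F e = ⊥-elim (n03 (sym e))
  go 3F 1F e = ⊥-elim (n13 (sym e))
  go 3F 2F e = ⊥-elim (n23 (sym e))
  go 3F 3F _ = refl

module QuadrangularFaces {n} {H : Graph n} (R : RotationSystem H) {F} (faceReps : HasFaces R F)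
                         (quad : ∀ d → QuadrangularAt (φ R) tail d) where

  private
    rep = proj₁ faceReps
    rep-injective = proj₁ (proj₂ faceReps)
    rep-covers = proj₂ (proj₂ faceReps)

  corner : Fin F × Fin 4 → Dart H
  corner (i , r) = iter (φ R) (toℕ r) (rep i)

  corner-returns : ∀ d (r : Fin 4) → Reaches (φ R) (iter (φ R) (toℕ r) d) d
  corner-returns d r = Reaches-return (φ R) (proj₁ (quad d)) (<⇒≤ (toℕ<n r))

  corner-injective : ∀ x y → corner x ≡ corner y → x ≡ y
  corner-injective (i , r) (j , s) e = cong₂ _,_ i≡j
    (QuadrangularAt-tails-injective {f = φ R} {tail} (quad (rep i)) r s
      (cong tail (trans e (cong (λ k → iter (φ R) (toℕ s) (rep k)) (sym i≡j)))))
    where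
    i≡j : i ≡ j
    i≡j = sym (rep-injective j i (Reaches-trans (toℕ s , sym e) (corner-returns (rep i) r)))

  locate : Dart H → Fin F × Fin 4
  locate d = proj₁ (rep-covers d) , fromℕ< (m%n<n (proj₁ (proj₂ (rep-covers d))) 4)

  corner-locate : ∀ d → corner (locate d) ≡ d
  corner-locate d with rep-covers d
  ... | i , k , reached = begin
    iter (φ R) (toℕ (fromℕ< (m%n<n k 4))) (rep i) ≡⟨ cong (λ m → iter (φ R) m (rep i)) (toℕ-fromℕ< (m%n<n k 4)) ⟩
    iter (φ R) (k % 4) (rep i)                    ≡⟨ iter-%-period (φ R) 4 (proj₁ ∘ quad) k (rep i) ⟩
    iter (φ R) k (rep i)                          ≡⟨ reached ⟩
    d                                             ∎
    where open ≡-Reasoning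

  darts↔corners : Dart H ↔ (Fin F × Fin 4)
  darts↔corners = mk↔ₛ′ locate corner
    (λ x → corner-injective _ _ (corner-locate (corner x))) corner-locate

degSum-quadrangulation : ∀ {n} {H : Graph n} {g} (Q : Quadrangulation H g) → degSum H ≡ nFaces (proj₁ Q) * 4
degSum-quadrangulation {H = H} (E , quad) = Fin-↔⇒≡
  (↔-trans (darts↔ H) (↔-trans (QuadrangularFaces.darts↔corners (rot E) (faces E) quad) (↔-sym *↔×)))

quadrangulation-identity : ∀ n F g E → n + F + 2 * g ≡ E + 2 → F * 4 ≡ 2 * E → 4 * n + 8 * g ≡ 2 * E + 8
quadrangulation-identity n F g E euler-formula count = +-cancelʳ-≡ (2 * E) _ _ (begin
  4 * n + 8 * g + 2 * E    ≡⟨ cong (4 * n + 8 * g +_) (sym count) ⟩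
  4 * n + 8 * g + F * 4    ≡⟨ solve (n ∷ F ∷ g ∷ []) ⟩
  4 * (n + F + 2 * g)      ≡⟨ cong (4 *_) euler-formula ⟩
  4 * (E + 2)              ≡⟨ solve (E ∷ []) ⟩
  2 * E + 8 + 2 * E        ∎)
  where open ≡-Reasoning

quadrangulation-vertex-bound : ∀ {n} {H : Graph n} {g} → Quadrangulation H g → 4 * n + 8 * g ≤ n * (n ∸ 1) + 8
quadrangulation-vertex-bound {n} {H} {g} Q = begin
  4 * n + 8 * g       ≡⟨ quadrangulation-identity n (nFaces (proj₁ Q)) g (numEdges H) (euler (proj₁ Q))
                           (trans (sym (degSum-quadrangulation Q)) (handshake H)) ⟩
  2 * numEdges H + 8  ≡⟨ cong (_+ 8) (sym (handshake H)) ⟩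
  degSum H + 8        ≤⟨ +-monoˡ-≤ 8 (degSum-≤ H) ⟩
  n * (n ∸ 1) + 8     ∎
  where open ≤-Reasoning

_++ʷ_ : ∀ {n} {G : Graph n} {u v w} → Walk G u v → Walk G v w → Walk G u w
here     ++ʷ W = W
step e V ++ʷ W = step e (V ++ʷ W)

connected⇒neighbour : ∀ {n} (G : Graph n) → 2 ≤ n → Connected G → ∀ v → ∃ λ w → T (adj G v w)
connected⇒neighbour {suc (suc n)} G (s≤s (s≤s z≤n)) conn v = first-step (conn v (other v)) (other-≢ v)
  where
  other : Fin (suc (suc n)) → Fin (suc (suc n))
  other F.zero    = F.suc F.zero
  other (F.suc _) = F.zero
  other-≢ : ∀ v → v ≢ other v
  other-≢ F.zero    ()
  other-≢ (F.suc _) ()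
  first-step : ∀ {w} → Walk G v w → v ≢ w → ∃ λ w → T (adj G v w)
  first-step here       v≢v = ⊥-elim (v≢v refl)
  first-step (step e _) _   = _ , e

interlace-euler : ∀ p e g → g + p ≡ e + 1 → (p + p) + 2 * e + 2 * g ≡ 2 * (2 * e) + 2
interlace-euler p e g genus = begin
  (p + p) + 2 * e + 2 * g ≡⟨ solve (p ∷ e ∷ g ∷ []) ⟩
  2 * (g + p) + 2 * e     ≡⟨ cong (λ x → 2 * x + 2 * e) genus ⟩
  2 * (e + 1) + 2 * e     ≡⟨ solve (e ∷ []) ⟩
  2 * (2 * e) + 2         ∎
  where open ≡-Reasoning

module Interlacement {p : ℕ} (G : Graph p) where

  IG : Graph (p + p)
  IG = interlace G

  side : Fin (p + p) → Bool
  side x = [ const false , const true ] (splitAt p x)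

  embed : Bool → Fin p → Fin (p + p)
  embed false u = u ↑ˡ p
  embed true  u = p ↑ʳ u

  base-embed : ∀ s u → base {p} (embed s u) ≡ u
  base-embed false u = cong [ id , id ] (splitAt-↑ˡ p u p)
  base-embed true  u = cong [ id , id ] (splitAt-↑ʳ p p u)

  side-embed : ∀ s u → side (embed s u) ≡ s
  side-embed false u = cong [ const false , const true ] (splitAt-↑ˡ p u p)
  side-embed true  u = cong [ const false , const true ] (splitAt-↑ʳ p p u)

  embed-side-base : ∀ x → embed (side x) (base x) ≡ x
  embed-side-base x with splitAt p x in eq
  ... | inj₁ _ = trans (cong (join p p) (sym eq)) (join-splitAt p p x)
  ... | inj₂ _ = trans (cong (join p p) (sym eq)) (join-splitAt p p x)

  embed-injective : ∀ s {u v} → embed s u ≡ embed s v → u ≡ v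
  embed-injective s {u} {v} e = trans (sym (base-embed s u)) (trans (cong base e) (base-embed s v))

  embed-crossing : ∀ u v → embed false u ≢ embed true v
  embed-crossing u v e with trans (sym (side-embed false u)) (trans (cong side e) (side-embed true v))
  ... | ()

  embed-adj : ∀ s t {u v} → T (adj G u v) → T (adj IG (embed s u) (embed t v))
  embed-adj s t {u} {v} = subst T (sym (cong₂ (adj G) (base-embed s u) (base-embed t v)))

  deg-interlace : ∀ x → deg IG x ≡ deg G (base x) + deg G (base x)
  deg-interlace x = trans (sumFin-↑ {p} {p} _)
    (cong₂ _+_ (sumFin-cong (λ v → cong (indicator ∘ adj G (base x)) (base-embed false v)))
               (sumFin-cong (λ v → cong (indicator ∘ adj G (base x)) (base-embed true v))))

  degSum-interlace : degSum IG ≡ 4 * degSum G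
  degSum-interlace = begin
    degSum IG
      ≡⟨ sumFin-↑ {p} {p} _ ⟩
    sumFin (λ u → deg IG (embed false u)) + sumFin (λ u → deg IG (embed true u))
      ≡⟨ cong₂ _+_ (doubled false) (doubled true) ⟩
    (degSum G + degSum G) + (degSum G + degSum G)
      ≡⟨ quadruple (degSum G) ⟩
    4 * degSum G ∎
    where
    open ≡-Reasoning
    quadruple : ∀ x → (x + x) + (x + x) ≡ 4 * x
    quadruple = solve-∀
    doubled : ∀ s → sumFin (λ u → deg IG (embed s u)) ≡ degSum G + degSum G
    doubled s = trans (sumFin-cong (λ u → trans (deg-interlace (embed s u))
                                                (cong (λ v → deg G v + deg G v) (base-embed s u))))
                      (sumFin-+ (deg G) (deg G))

  numEdges-interlace : numEdges IG ≡ 2 * degSum G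
  numEdges-interlace = *-cancelˡ-≡ _ _ 2 (begin
    2 * numEdges IG    ≡⟨ sym (handshake IG) ⟩
    degSum IG          ≡⟨ degSum-interlace ⟩
    4 * degSum G       ≡⟨ *-assoc 2 2 (degSum G) ⟩
    2 * (2 * degSum G) ∎)
    where open ≡-Reasoning

  open Rotation G

  -- A dart x → y of G[:] is labelled by side x, side y (false for G′, true for G″) and the
  -- dart base x → base y of G.
  Label : Set
  Label = Bool × Bool × Dart G

  label : Dart IG → Label
  label d = side (tail d) , side (head d) , dart (base (tail d)) (base (head d)) (isEdge d)

  unlabel : Label → Dart IG
  unlabel (s , t , d) = dart (embed s (tail d)) (embed t (head d)) (embed-adj s t (isEdge d))

  label-unlabel : ∀ X → label (unlabel X) ≡ X
  label-unlabel (s , t , d) = cong₂ _,_ (side-embed s _)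
    (cong₂ _,_ (side-embed t _) (Dart-≡ (base-embed s _) (base-embed t _)))

  unlabel-label : ∀ d → unlabel (label d) ≡ d
  unlabel-label d = Dart-≡ (embed-side-base (tail d)) (embed-side-base (head d))

  rotL : Label → Label
  rotL (false , false , d) = false , true  , d
  rotL (false , true  , d) = false , false , prev d
  rotL (true  , false , d) = true  , true  , next d
  rotL (true  , true  , d) = true  , false , d

  unrotL : Label → Label
  unrotL (false , false , d) = false , true  , next d
  unrotL (false , true  , d) = false , false , d
  unrotL (true  , false , d) = true  , true  , d
  unrotL (true  , true  , d) = true  , false , prev d

  unrotL-rotL : ∀ X → unrotL (rotL X) ≡ X
  unrotL-rotL (false , false , d) = refl
  unrotL-rotL (false , true  , d) = cong (λ e → false , true , e) (next-prev d)
  unrotL-rotL (true  , false , d) = cong (λ e → true , false , e) (prev-next d)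
  unrotL-rotL (true  , true  , d) = refl

  tail-rotL : ∀ X → tail (unlabel (rotL X)) ≡ tail (unlabel X)
  tail-rotL (false , false , d) = refl
  tail-rotL (false , true  , d) = refl
  tail-rotL (true  , false , d) = refl
  tail-rotL (true  , true  , d) = refl

  -- Every label reaches, and is reached from, a label with head in G′; between those, rotL
  -- follows the rotation of G.
  along : ∀ s d d' → tail d ≡ tail d' → Reaches rotL (s , false , d) (s , false , d')
  along false d d' eq = Reaches-map (λ e → false , false , e) (λ _ → 2 , refl) (prev-reaches d d' eq)
  along true  d d' eq = Reaches-map (λ e → true  , false , e) (λ _ → 2 , refl) (next-reaches d d' eq)

  descend : ∀ X → Σ (Dart G) λ e → tail e ≡ tail (proj₂ (proj₂ X)) × Reaches rotL X (proj₁ X , false , e)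
  descend (false , false , d) = d      , refl , 0 , refl
  descend (false , true  , d) = prev d , refl , 1 , refl
  descend (true  , false , d) = d      , refl , 0 , refl
  descend (true  , true  , d) = d      , refl , 1 , refl

  ascend : ∀ X → Σ (Dart G) λ e → tail e ≡ tail (proj₂ (proj₂ X)) × Reaches rotL (proj₁ X , false , e) X
  ascend (false , false , d) = d      , refl , 0 , refl
  ascend (false , true  , d) = d      , refl , 1 , refl
  ascend (true  , false , d) = d      , refl , 0 , refl
  ascend (true  , true  , d) = prev d , refl , 1 , cong (λ e → true , true , e) (next-prev d)

  rotL-reaches : ∀ X Y → proj₁ X ≡ proj₁ Y → tail (proj₂ (proj₂ X)) ≡ tail (proj₂ (proj₂ Y)) → Reaches rotL X Y
  rotL-reaches X Y refl eq with descend X | ascend Y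
  ... | d , dX , X→d | d' , d'Y , d'→Y =
    Reaches-trans X→d (Reaches-trans (along (proj₁ X) d d' (trans dX (trans eq (sym d'Y)))) d'→Y)

  -- Opaque because unfolding it lets the face computations below expand the enumeration of
  -- neighbours, which exhausts memory.
  opaque
    rotate : Dart IG → Dart IG
    rotate = unlabel ∘ rotL ∘ label

    rotate-unlabel : ∀ X → rotate (unlabel X) ≡ unlabel (rotL X)
    rotate-unlabel X = cong (unlabel ∘ rotL) (label-unlabel X)

    label-rotate : ∀ d → label (rotate d) ≡ rotL (label d)
    label-rotate d = label-unlabel (rotL (label d))

    rotate-tail : ∀ d → tail (rotate d) ≡ tail d
    rotate-tail d = trans (tail-rotL (label d)) (cong tail (unlabel-label d))

  rotate-injective : ∀ d d' → rotate d ≡ rotate d' → d ≡ d'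
  rotate-injective d d' e = begin
    d                                      ≡⟨ sym (unlabel-label d) ⟩
    unlabel (label d)                      ≡⟨ cong unlabel (sym (unrotL-rotL (label d))) ⟩
    unlabel (unrotL (rotL (label d)))      ≡⟨ cong (unlabel ∘ unrotL) rotL-label ⟩
    unlabel (unrotL (rotL (label d')))     ≡⟨ cong unlabel (unrotL-rotL (label d')) ⟩
    unlabel (label d')                     ≡⟨ unlabel-label d' ⟩
    d'                                     ∎
    where
    open ≡-Reasoning
    rotL-label : rotL (label d) ≡ rotL (label d')
    rotL-label = trans (sym (label-rotate d)) (trans (cong label e) (label-rotate d'))

  rotate-reaches : ∀ d d' → tail d ≡ tail d' → Reaches rotate d d'
  rotate-reaches d d' e = subst₂ (Reaches rotate) (unlabel-label d) (unlabel-label d')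
    (Reaches-map unlabel (λ X → 1 , rotate-unlabel X) (rotL-reaches (label d) (label d') (cong side e) (cong base e)))

  rotation : RotationSystem IG
  rotation = record { ρ = rotate ; ρ-tail = rotate-tail ; ρ-inj = rotate-injective ; ρ-cyclic = rotate-reaches }

  revL : Label → Label
  revL (s , t , d) = t , s , rev d

  faceL : Label → Label
  faceL = rotL ∘ revL

  φ-unlabel : ∀ X → φ rotation (unlabel X) ≡ unlabel (faceL X)
  φ-unlabel X = trans (cong rotate (Dart-≡ refl refl)) (rotate-unlabel (revL X))

  label-φ : ∀ d → label (φ rotation d) ≡ faceL (label d)
  label-φ d = begin
    label (φ rotation d)                   ≡⟨ cong (label ∘ φ rotation) (sym (unlabel-label d)) ⟩
    label (φ rotation (unlabel (label d))) ≡⟨ cong label (φ-unlabel (label d)) ⟩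
    label (unlabel (faceL (label d)))      ≡⟨ label-unlabel _ ⟩
    faceL (label d)                        ∎
    where open ≡-Reasoning

  -- face X is the unique dart inside G′ on the face of X.
  face : Label → Dart G
  face (false , false , d) = d
  face (false , true  , d) = rev d
  face (true  , true  , d) = prev d
  face (true  , false , d) = prev (rev d)

  face-faceL : ∀ X → face (faceL X) ≡ face X
  face-faceL (false , false , d) = rev-involutive d
  face-faceL (false , true  , d) = prev-next (rev d)
  face-faceL (true  , true  , d) = cong prev (rev-involutive d)
  face-faceL (true  , false , d) = refl

  faceL-reaches : ∀ X → Reaches faceL (false , false , face X) X
  faceL-reaches (false , false , d) = 0 , refl
  faceL-reaches (false , true  , d) = 1 , cong (λ e → false , true , e) (rev-involutive d)
  faceL-reaches (true  , true  , d) = 2 , cong (λ e → true , true , e)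
    (trans (cong next (rev-involutive (prev d))) (next-prev d))
  faceL-reaches (true  , false , d) = 3 , cong (λ e → true , false , e)
    (trans (cong (rev ∘ next) (rev-involutive (prev (rev d))))
           (trans (cong rev (next-prev (rev d))) (rev-involutive d)))

  quadrangular-label : ∀ d → QuadrangularAt faceL (tail ∘ unlabel) (false , false , d)
  quadrangular-label d =
    cong (λ e → false , false , e)
      (trans (cong prev (rev-involutive _)) (trans (cong (prev ∘ next) (rev-involutive d)) (prev-next d)))
    , adj⇒≢ G (isEdge d) ∘ embed-injective false
    , embed-crossing _ _ , embed-crossing _ _ , embed-crossing _ _ , embed-crossing _ _
    , adj⇒≢ G (isEdge (next (rev (rev d)))) ∘ embed-injective true

  faceLabel : Fin (degSum G) → Label
  faceLabel i = false , false , to (darts↔ G) i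

  faceDart : Fin (degSum G) → Dart IG
  faceDart = unlabel ∘ faceLabel

  faceDart-injective : ∀ i j → SameFace rotation (faceDart i) (faceDart j) → i ≡ j
  faceDart-injective i j reach = begin
    i                              ≡⟨ sym (strictlyInverseʳ (darts↔ G) i) ⟩
    from (darts↔ G) (to (darts↔ G) i) ≡⟨ cong (from (darts↔ G)) same-face ⟩
    from (darts↔ G) (to (darts↔ G) j) ≡⟨ strictlyInverseʳ (darts↔ G) j ⟩
    j                              ∎
    where
    open ≡-Reasoning
    same-face : to (darts↔ G) i ≡ to (darts↔ G) j
    same-face = Reaches-invariant face face-faceL
      (subst₂ (Reaches faceL) (label-unlabel (faceLabel i)) (label-unlabel (faceLabel j))
        (Reaches-map label (λ d → 1 , sym (label-φ d)) reach))

  faceDart-covers : ∀ d → ∃ λ i → SameFace rotation (faceDart i) d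
  faceDart-covers d = from (darts↔ G) (face (label d)) , subst₂ (SameFace rotation)
    (cong (λ e → unlabel (false , false , e)) (sym (strictlyInverseˡ (darts↔ G) _))) (unlabel-label d)
    (Reaches-map unlabel (λ X → 1 , φ-unlabel X) (faceL-reaches (label d)))

  faceDarts : HasFaces rotation (degSum G)
  faceDarts = faceDart , faceDart-injective , faceDart-covers

  quadrangular-faceDart : ∀ i → QuadrangularAt (φ rotation) tail (faceDart i)
  quadrangular-faceDart i = QuadrangularAt-map {f = faceL} {φ rotation} {tail} unlabel (sym ∘ φ-unlabel)
    {faceLabel i} (quadrangular-label (to (darts↔ G) i))

  quadrangular : ∀ d → QuadrangularAt (φ rotation) tail d
  quadrangular d = QuadrangularAt-reaches {f = φ rotation} {tail}
    (quadrangular-faceDart (proj₁ (faceDart-covers d))) (proj₂ (faceDart-covers d))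

  lift : ∀ s {u v} → Walk G u v → Walk IG (embed s u) (embed s v)
  lift s here       = here
  lift s (step e W) = step (embed-adj s s e) (lift s W)

  switch : ∀ s t {v w} → T (adj G v w) → Walk IG (embed s v) (embed t v)
  switch s t {v} {w} e = step (embed-adj s t e) (step (embed-adj t t (subst T (adj-sym G v w) e)) here)

  interlace-connected : (∀ v → ∃ λ w → T (adj G v w)) → Connected G → Connected IG
  interlace-connected neighbour conn x y = subst₂ (Walk IG) (embed-side-base x) (embed-side-base y)
    (lift (side x) (conn (base x) (base y)) ++ʷ switch (side x) (side y) (proj₂ (neighbour (base y))))

  interlace-quadrangulation : ∀ g → 2 ≤ p → Connected G → g + p ≡ numEdges G + 1 → Quadrangulation IG g
  interlace-quadrangulation g 2≤p conn genus = embedding , quadrangular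
    where
    open ≡-Reasoning
    E = numEdges G
    embedding : Embedding IG g
    embedding = record
      { connected = interlace-connected (connected⇒neighbour G 2≤p conn) conn
      ; rot       = rotation
      ; nFaces    = degSum G
      ; faces     = faceDarts
      ; euler     = begin
          (p + p) + degSum G + 2 * g ≡⟨ cong (λ x → (p + p) + x + 2 * g) (handshake G) ⟩
          (p + p) + 2 * E + 2 * g    ≡⟨ interlace-euler p E g genus ⟩
          2 * (2 * E) + 2            ≡⟨ cong (λ x → 2 * x + 2) (sym (handshake G)) ⟩
          2 * degSum G + 2           ≡⟨ cong (_+ 2) (sym numEdges-interlace) ⟩
          numEdges IG + 2            ∎
      }

2*n≤n*[n∸1]+2 : ∀ n → 2 * n ≤ n * (n ∸ 1) + 2
2*n≤n*[n∸1]+2 zero          = z≤n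
2*n≤n*[n∸1]+2 (suc zero)    = ≤-refl
2*n≤n*[n∸1]+2 (suc (suc k)) = begin
  2 * (2 + k)                       ≤⟨ m≤m+n (2 * (2 + k)) (k + k * k) ⟩
  2 * (2 + k) + (k + k * k)         ≡⟨ solve (k ∷ []) ⟩
  (2 + k) * (1 + k) + 2             ∎
  where open ≤-Reasoning

genus-shift : ∀ x m p e k → x + m + p ≡ k + 1 → e + m ≡ k → x + p ≡ e + 1
genus-shift x m p e k h₁ h₂ = +-cancelʳ-≡ m _ _ (begin
  x + p + m     ≡⟨ solve (x ∷ p ∷ m ∷ []) ⟩
  x + m + p     ≡⟨ h₁ ⟩
  k + 1         ≡⟨ cong (_+ 1) (sym h₂) ⟩
  e + m + 1     ≡⟨ solve (e ∷ m ∷ []) ⟩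
  e + 1 + m     ∎)
  where open ≡-Reasoning

square-excess-mono : ∀ a t → 5 ≤ a + t → a * (a ∸ 1) + 4 * (a + t) ≤ (a + t) * (a + t ∸ 1) + 4 * a
square-excess-mono zero    (suc s) 5≤t = begin
  4 * suc s       ≡⟨ *-comm 4 (suc s) ⟩
  suc s * 4       ≤⟨ *-monoʳ-≤ (suc s) (s≤s⁻¹ 5≤t) ⟩
  suc s * s       ≡⟨ sym (+-identityʳ _) ⟩
  suc s * s + 0   ∎
  where open ≤-Reasoning
square-excess-mono (suc b) t 5≤a+t = begin
  (1 + b) * b + 4 * (1 + b + t)           ≡⟨ solve (b ∷ t ∷ []) ⟩
  ((1 + b) * b + 4 * (1 + b)) + t * 4     ≤⟨ +-monoʳ-≤ ((1 + b) * b + 4 * (1 + b)) (*-monoʳ-≤ t 4≤2b+t+1) ⟩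
  ((1 + b) * b + 4 * (1 + b)) + t * (b + b + 1 + t) ≡⟨ solve (b ∷ t ∷ []) ⟩
  (1 + b + t) * (b + t) + 4 * (1 + b)     ∎
  where
  open ≤-Reasoning
  4≤2b+t+1 : 4 ≤ b + b + 1 + t
  4≤2b+t+1 = ≤-trans (s≤s⁻¹ 5≤a+t) (+-monoˡ-≤ t (≤-trans (m≤m+n b b) (m≤m+n (b + b) 1)))

vertex-bound-mono : ∀ {a N g} → a ≤ N → 5 ≤ N →
  4 * a + 8 * g ≤ a * (a ∸ 1) + 8 → 4 * N + 8 * g ≤ N * (N ∸ 1) + 8
vertex-bound-mono {a} {N} {g} a≤N 5≤N bound with m≤n⇒∃[o]m+o≡n a≤N
... | t , refl = combine (4 * a) (4 * (a + t)) (8 * g) (a * (a ∸ 1)) ((a + t) * (a + t ∸ 1))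
                          bound (square-excess-mono a t 5≤N)
  where
  combine : ∀ A N G X Y → A + G ≤ X + 8 → X + N ≤ Y + A → N + G ≤ Y + 8
  combine A N G X Y h₁ h₂ = +-cancelʳ-≤ A _ _ (begin
    N + G + A     ≡⟨ solve (N ∷ G ∷ A ∷ []) ⟩
    (A + G) + N   ≤⟨ +-monoˡ-≤ N h₁ ⟩
    X + 8 + N     ≡⟨ solve (X ∷ N ∷ []) ⟩
    (X + N) + 8   ≤⟨ +-monoˡ-≤ 8 h₂ ⟩
    Y + A + 8     ≡⟨ solve (Y ∷ A ∷ []) ⟩
    Y + 8 + A     ∎)
    where open ≤-Reasoning

too-few-vertices : ∀ q g m → 4 * (1 + (q + q)) + 8 * g ≤ (1 + (q + q)) * (q + q) + 8 →
  2 * (g + m + (1 + q)) ≡ (1 + q) * q + 2 → 4 * (m + 1) ≤ 1 + q → ⊥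
too-few-vertices q g m bound genus 4m+4≤p = m+1+n≰m (4 * q * q + 10 * q + 8 * m + 16) (≤-trans gap excess)
  where
  open ≤-Reasoning
  excess : 4 * q * q + 12 * q + 12 ≤ 4 * q * q + 10 * q + 8 * m + 16
  excess = begin
    4 * q * q + 12 * q + 12                         ≡⟨ solve (q ∷ []) ⟩
    4 * (1 + (q + q)) + 4 * ((1 + q) * q + 2)       ≡⟨ cong (λ x → 4 * (1 + (q + q)) + 4 * x) (sym genus) ⟩
    4 * (1 + (q + q)) + 4 * (2 * (g + m + (1 + q))) ≡⟨ solve (q ∷ g ∷ m ∷ []) ⟩
    (4 * (1 + (q + q)) + 8 * g) + (8 * m + 8 * (1 + q)) ≤⟨ +-monoˡ-≤ (8 * m + 8 * (1 + q)) bound ⟩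
    ((1 + (q + q)) * (q + q) + 8) + (8 * m + 8 * (1 + q)) ≡⟨ solve (q ∷ m ∷ []) ⟩
    4 * q * q + 10 * q + 8 * m + 16                 ∎
  8m+6≤2q : 8 * m + 6 ≤ 2 * q
  8m+6≤2q = +-cancelʳ-≤ 2 _ _ (begin
    8 * m + 6 + 2     ≡⟨ solve (m ∷ []) ⟩
    2 * (4 * (m + 1)) ≤⟨ *-monoʳ-≤ 2 4m+4≤p ⟩
    2 * (1 + q)       ≡⟨ solve (q ∷ []) ⟩
    2 * q + 2         ∎)
  gap : 4 * q * q + 10 * q + 8 * m + 16 + 2 ≤ 4 * q * q + 12 * q + 12
  gap = begin
    4 * q * q + 10 * q + 8 * m + 16 + 2     ≡⟨ solve (q ∷ m ∷ []) ⟩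
    (4 * q * q + 10 * q + 12) + (8 * m + 6) ≤⟨ +-monoʳ-≤ (4 * q * q + 10 * q + 12) 8m+6≤2q ⟩
    (4 * q * q + 10 * q + 12) + 2 * q       ≡⟨ solve (q ∷ []) ⟩
    4 * q * q + 12 * q + 12                 ∎

many-vertices : ∀ a g m p → 4 * a + 8 * g ≤ a * (a ∸ 1) + 8 →
  2 * (g + m + p) ≡ p * (p ∸ 1) + 2 → 4 * (m + 1) ≤ p → p + p ≤ a
many-vertices a g m zero    bound genus 4m+4≤0 with ≤-trans (*-monoʳ-≤ 4 (m≤n+m 1 m)) 4m+4≤0
... | ()
many-vertices a g m (suc q) bound genus 4m+4≤p with suc q + suc q ≤? a
... | yes enough = enough
... | no  a≱2p   = ⊥-elim (too-few-vertices q g m (vertex-bound-mono {g = g} a≤N 5≤N bound) genus 4m+4≤p)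
  where
  a≤N : a ≤ 1 + (q + q)
  a≤N = s≤s⁻¹ (subst (a <_) (+-suc (suc q) q) (≰⇒> a≱2p))
  5≤N : 5 ≤ 1 + (q + q)
  3≤q : 3 ≤ q
  3≤q = s≤s⁻¹ (≤-trans (*-monoʳ-≤ 4 (m≤n+m 1 m)) 4m+4≤p)
  5≤N = s≤s (+-mono-≤ 3≤q (≤-trans (s≤s z≤n) 3≤q))

numEdges-complete : ∀ n → 2 * numEdges (complete n) ≡ n * (n ∸ 1)
numEdges-complete n = trans (sym (handshake (complete n))) (degSum-complete n)

β-complete-+ : ∀ n → β (complete n) + n ≡ numEdges (complete n) + 1
β-complete-+ n = m∸n+n≡m {numEdges (complete n) + 1} {n} (*-cancelˡ-≤ 2 (begin
  2 * n                                 ≤⟨ 2*n≤n*[n∸1]+2 n ⟩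
  n * (n ∸ 1) + 2                       ≡⟨ cong (_+ 2) (sym (numEdges-complete n)) ⟩
  2 * numEdges (complete n) + 2         ≡⟨ sym (*-distribˡ-+ 2 (numEdges (complete n)) 1) ⟩
  2 * (numEdges (complete n) + 1)       ∎))
  where open ≤-Reasoning

theorem2 : ∀ (p m : ℕ) → 2 ≤ p → m ≤ β (complete p)
    → (G : Graph p) → numEdges G + m ≡ numEdges (complete p)
    → Connected G
    → Quadrangulation (interlace G) (β (complete p) ∸ m)
      × (1 ≤ β (complete p) ∸ m → 4 * (m + 1) ≤ p
         → ∀ (Q : Quadrangulation (interlace G) (β (complete p) ∸ m)) → IsMinimal Q)
theorem2 p m 2≤p m≤β G edges conn =
  Interlacement.interlace-quadrangulation G g 2≤p conn genus , minimal
  where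
  g = β (complete p) ∸ m
  EK = numEdges (complete p)
  total : g + m + p ≡ EK + 1
  total = trans (cong (_+ p) (m∸n+n≡m m≤β)) (β-complete-+ p)
  genus : g + p ≡ numEdges G + 1
  genus = genus-shift g m p (numEdges G) EK total edges
  minimal : 1 ≤ g → 4 * (m + 1) ≤ p → ∀ Q → IsMinimal {G = interlace G} Q
  minimal _ 4m+4≤p _ n H Q = many-vertices n g m p (quadrangulation-vertex-bound Q)
    (trans (cong (2 *_) total) (trans (*-distribˡ-+ 2 EK 1) (cong (_+ 2) (numEdges-complete p)))) 4m+4≤p
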